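{- Let $F$ be a forest and $d$ a nonnegative integer. If a graph $G$ has minimum degree at least $d$, then the number of (unlabeled) copies of $F$ in $G$ is at least the number of (unlabeled) copies of $F$ in $K_{d+1}$.
   Context: All graphs are finite and simple (and $G$ has at least one vertex). A copy of $F$ in $G$ is a subgraph of $G$ isomorphic to $F$. -}

module Defs where

open import Data.Nat using (ℕ; zero; suc; _≤_)
open import Data.Bool using (Bool; true; false; _∧_; _∨_; not; if_then_else_)
open import Data.Fin using (Fin; zero; suc; inject₁; fromℕ)
open import Data.Fin.Properties using (_≟_)
open import Data.List using (List; []; _∷_; concatMap; map; allFin)
open import Data.Vec using (Vec; []; _∷_; lookup)
open import Data.Product using (Σ; _×_; _,_)
open import Relation.Nullary using (¬_)
open import Relation.Nullary.Decidable using (⌊_⌋)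
open import Relation.Binary.PropositionalEquality using (_≡_)
open import Function.Definitions using (Injective)

record Graph : Set where
  field
    n      : ℕ
    adj    : Fin n → Fin n → Bool
    sym    : ∀ u v → adj u v ≡ adj v u
    irrefl : ∀ v → adj v v ≡ false
open Graph public

_==_ : ∀ {m} → Fin m → Fin m → Bool
a == b = ⌊ a ≟ b ⌋

_⇒b_ : Bool → Bool → Bool
a ⇒b b = not a ∨ b

allL : ∀ {A : Set} → List A → (A → Bool) → Bool
allL []       p = true
allL (x ∷ xs) p = p x ∧ allL xs p

anyL : ∀ {A : Set} → List A → (A → Bool) → Bool
anyL []       p = false
anyL (x ∷ xs) p = p x ∨ anyL xs p

countL : ∀ {A : Set} → List A → (A → Bool) → ℕ
countL []       p = zero
countL (x ∷ xs) p = if p x then suc (countL xs p) else countL xs p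

vecsOf : ∀ {A : Set} → List A → (m : ℕ) → List (Vec A m)
vecsOf xs zero    = [] ∷ []
vecsOf xs (suc m) = concatMap (λ x → map (x ∷_) (vecsOf xs m)) xs

bools : List Bool
bools = false ∷ true ∷ []

degree : (G : Graph) → Fin (n G) → ℕ
degree G v = countL (allFin (n G)) (λ u → adj G v u)

MinDegreeAtLeast : Graph → ℕ → Set
MinDegreeAtLeast G d = ∀ v → d ≤ degree G v

-- Forests: graphs with no cycle. A cycle is a cyclic sequence of
-- m+3 ≥ 3 pairwise distinct vertices, consecutive ones adjacent.
HasCycle : Graph → Set
HasCycle G =
  Σ ℕ λ m → Σ (Fin (suc (suc (suc m))) → Fin (n G)) λ c →
    Injective _≡_ _≡_ c
    × (∀ (i : Fin (suc (suc m))) → adj G (c (inject₁ i)) (c (suc i)) ≡ true)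
    × (adj G (c (fromℕ (suc (suc m)))) (c zero) ≡ true)

IsForest : Graph → Set
IsForest G = ¬ HasCycle G

completeAdj : (m : ℕ) → Fin m → Fin m → Bool
completeAdj m u v = not (u == v)

complete-sym : ∀ {m} (u v : Fin m) → completeAdj m u v ≡ completeAdj m v u
complete-sym u v with u ≟ v | v ≟ u
... | Relation.Nullary.yes p | Relation.Nullary.yes q = Relation.Binary.PropositionalEquality.refl
... | Relation.Nullary.yes p | Relation.Nullary.no q = Data.Empty.⊥-elim (q (Relation.Binary.PropositionalEquality.sym p))
  where import Data.Empty
... | Relation.Nullary.no p | Relation.Nullary.yes q = Data.Empty.⊥-elim (p (Relation.Binary.PropositionalEquality.sym q))
  where import Data.Empty
... | Relation.Nullary.no p | Relation.Nullary.no q = Relation.Binary.PropositionalEquality.refl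

complete-irrefl : ∀ {m} (v : Fin m) → completeAdj m v v ≡ false
complete-irrefl v with v ≟ v
... | Relation.Nullary.yes _ = Relation.Binary.PropositionalEquality.refl
... | Relation.Nullary.no ¬p = Data.Empty.⊥-elim (¬p Relation.Binary.PropositionalEquality.refl)
  where import Data.Empty

K : ℕ → Graph
K m = record { n = m ; adj = completeAdj m ; sym = complete-sym ; irrefl = complete-irrefl }

-- Copies of F in G: subgraphs H = (V_H, E_H) of G (vertex set as a Bool
-- vector, edge set as a Bool adjacency matrix) that are isomorphic to F.
-- Distinct copies = distinct (V_H, E_H) (unlabeled copies).
SubData : ℕ → Set
SubData m = Vec Bool m × Vec (Vec Bool m) m

allSubData : (m : ℕ) → List (SubData m)
allSubData m = concatMap (λ vs → map (vs ,_) (vecsOf (vecsOf bools m) m)) (vecsOf bools m)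

isSubgraph : (G : Graph) → SubData (n G) → Bool
isSubgraph G (vs , es) =
  allL (allFin (n G)) λ u → allL (allFin (n G)) λ v →
    (lookup (lookup es u) v ⇒b lookup (lookup es v) u) ∧
    (lookup (lookup es u) v ⇒b (lookup vs u ∧ lookup vs v ∧ adj G u v))

isIsoTo : (F : Graph) → ∀ {m} → SubData m → Bool
isIsoTo F {m} (vs , es) =
  anyL (vecsOf (allFin m) (n F)) λ φ →
    (allL (allFin (n F)) λ i → allL (allFin (n F)) λ j →
        not (i == j) ⇒b not (lookup φ i == lookup φ j))
    ∧ (allL (allFin (n F)) λ i → lookup vs (lookup φ i))
    ∧ (allL (allFin m) λ u → lookup vs u ⇒b anyL (allFin (n F)) (λ i → lookup φ i == u))
    ∧ (allL (allFin (n F)) λ i → allL (allFin (n F)) λ j →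
        ⌊ Data.Bool._≟_ (lookup (lookup es (lookup φ i)) (lookup φ j)) (adj F i j) ⌋)
  where import Data.Bool

isCopy : (F G : Graph) → SubData (n G) → Bool
isCopy F G H = isSubgraph G H ∧ isIsoTo F H

copies : (F G : Graph) → ℕ
copies F G = countL (allSubData (n G)) (isCopy F G)

{-# OPTIONS --safe #-}
-- Count embeddings (injective adjacency-preserving maps F → X) instead of copies: each copy of F
-- is the image of exactly aut(F) embeddings, so #emb(F, X) = aut(F) · copies(F, X).
-- An embedding is built one vertex at a time.  In K_{d+1}, once k vertices are placed there are at
-- most d + 1 − k choices for the next one, so #emb(F, K_{d+1}) ≤ (d + 1)(d)⋯(d + 2 − |F|).
-- In G, first place F − v for a vertex v of degree ≤ 1 (every nonempty forest has one).  If v has a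
-- neighbour w, its image has at least d neighbours, at most k − 1 of them already used, leaving at
-- least d + 1 − k choices for v; if v is isolated, at least |G| − k ≥ d + 1 − k vertices are free.
-- Hence #emb(F, G) ≥ (d + 1)(d)⋯(d + 2 − |F|) ≥ #emb(F, K_{d+1}), and dividing by aut(F) ≥ 1 gives the claim.
module Submission where

open import Defs hiding (sym)
open import Data.Nat using (ℕ; zero; suc; pred; _+_; _*_; _∸_; _≤_; _<_; z≤n; s≤s; >-nonZero)
open import Data.Nat.Properties hiding (_≟_)
open import Data.Nat.Combinatorics.Base using (_P′_)
open import Data.Bool using (Bool; true; false; _∧_; _∨_; not; T?; if_then_else_)
import Data.Bool as Bool
open import Data.Bool.Properties using (T-≡)
open import Data.Fin using (Fin; zero; suc; punchIn; punchOut; inject₁; inject≤; fromℕ; toℕ; fromℕ<)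
import Data.Fin.Properties as Finₚ
open import Data.List
  using (List; []; _∷_; _++_; map; filter; length; allFin; concatMap; cartesianProductWith; cartesianProduct)
open import Data.List.Properties using (length-map; length-removeAt′; length-tabulate)
open import Data.List.Membership.Propositional using (_∈_)
open import Data.List.Membership.Propositional.Properties
  using (∈-allFin; ∈-filter⁺; ∈-filter⁻; ∈-map⁺; ∈-map⁻; ∈-cartesianProductWith⁺; ∈-cartesianProduct⁺)
open import Data.List.Relation.Unary.Any using (here; there; _─_)
open import Data.List.Relation.Unary.All using (All; []; _∷_)
open import Data.List.Relation.Unary.AllPairs using ([]; _∷_)
open import Data.List.Relation.Unary.Unique.Propositional using (Unique)
import Data.List.Relation.Unary.Unique.Propositional.Properties as Uniqueₚ
open import Data.List.Relation.Binary.Subset.Propositional using (_⊆_)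
open import Data.Vec using (Vec; lookup; tabulate; replicate; insertAt; removeAt)
import Data.Vec as Vec
import Data.Vec.Properties as Vecₚ
open import Data.Product using (Σ; ∃; ∃₂; _×_; _,_; proj₁; proj₂)
open import Data.Sum using (_⊎_; inj₁; inj₂)
open import Data.Empty using (⊥-elim)
open import Function using (_∘_; Equivalence)
open import Function.Definitions using (Injective)
open import Relation.Nullary using (¬_; Dec; yes; no)
open import Relation.Nullary.Decidable using (⌊_⌋; _×-dec_; ¬?; decidable-stable)
open import Relation.Binary.PropositionalEquality

private variable
  A B : Set
  m : ℕ

∧-true⁻ : ∀ {a b} → a ∧ b ≡ true → a ≡ true × b ≡ true
∧-true⁻ {true} {true} _ = refl , refl

∧-true⁺ : ∀ {a b} → a ≡ true → b ≡ true → a ∧ b ≡ true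
∧-true⁺ refl refl = refl

⇒b-true⁻ : ∀ {a b} → (a ⇒b b) ≡ true → a ≡ true → b ≡ true
⇒b-true⁻ {true} {true} _ _ = refl

⇒b-true⁺ : ∀ {a b} → (a ≡ true → b ≡ true) → (a ⇒b b) ≡ true
⇒b-true⁺ {true}  a⇒b = cong (false ∨_) (a⇒b refl)
⇒b-true⁺ {false} a⇒b = refl

not-true⁻ : ∀ {a} → not a ≡ true → a ≡ false
not-true⁻ {false} _ = refl

not-true⁺ : ∀ {a} → a ≡ false → not a ≡ true
not-true⁺ refl = refl

true≢false : true ≢ false
true≢false ()

Bool-ext : ∀ {a b} → (a ≡ true → b ≡ true) → (b ≡ true → a ≡ true) → a ≡ b
Bool-ext {true}          a⇒b b⇒a = sym (a⇒b refl)
Bool-ext {false} {true}  a⇒b b⇒a = b⇒a refl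
Bool-ext {false} {false} a⇒b b⇒a = refl

==-true⁻ : {a b : Fin m} → (a == b) ≡ true → a ≡ b
==-true⁻ {a = a} {b} eq with a Finₚ.≟ b
... | yes a≡b = a≡b

==-true⁺ : {a b : Fin m} → a ≡ b → (a == b) ≡ true
==-true⁺ {a = a} {b} a≡b with a Finₚ.≟ b
... | yes _   = refl
... | no  a≢b = ⊥-elim (a≢b a≡b)

==-false⁺ : {a b : Fin m} → a ≢ b → (a == b) ≡ false
==-false⁺ {a = a} {b} a≢b with a Finₚ.≟ b
... | yes a≡b = ⊥-elim (a≢b a≡b)
... | no  _   = refl

≟-true⁻ : ∀ {a b : Bool} → ⌊ a Bool.≟ b ⌋ ≡ true → a ≡ b
≟-true⁻ {a} {b} eq with a Bool.≟ b
... | yes a≡b = a≡b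

≟-true⁺ : ∀ {a b : Bool} → a ≡ b → ⌊ a Bool.≟ b ⌋ ≡ true
≟-true⁺ {a} {b} a≡b with a Bool.≟ b
... | yes _   = refl
... | no  a≢b = ⊥-elim (a≢b a≡b)

allL-true⁻ : (xs : List A) (p : A → Bool) → allL xs p ≡ true → ∀ {x} → x ∈ xs → p x ≡ true
allL-true⁻ (x ∷ xs) p all (here refl) = proj₁ (∧-true⁻ all)
allL-true⁻ (x ∷ xs) p all (there x∈)  = allL-true⁻ xs p (proj₂ (∧-true⁻ {p x} all)) x∈

allL-true⁺ : (xs : List A) (p : A → Bool) → (∀ {x} → x ∈ xs → p x ≡ true) → allL xs p ≡ true
allL-true⁺ []       p all = refl
allL-true⁺ (x ∷ xs) p all = ∧-true⁺ (all (here refl)) (allL-true⁺ xs p (all ∘ there))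

anyL-true⁻ : (xs : List A) (p : A → Bool) → anyL xs p ≡ true → Σ A λ x → x ∈ xs × p x ≡ true
anyL-true⁻ (x ∷ xs) p any with p x in px
... | true  = x , here refl , px
... | false with y , y∈ , py ← anyL-true⁻ xs p any = y , there y∈ , py

anyL-true⁺ : (xs : List A) (p : A → Bool) {x : A} → x ∈ xs → p x ≡ true → anyL xs p ≡ true
anyL-true⁺ (x ∷ xs) p (here refl) px rewrite px = refl
anyL-true⁺ (y ∷ xs) p (there x∈) px with p y
... | true  = refl
... | false = anyL-true⁺ xs p x∈ px

all-Fin-true⁻ : (p : Fin m → Bool) → allL (allFin m) p ≡ true → ∀ i → p i ≡ true
all-Fin-true⁻ {m} p all i = allL-true⁻ (allFin m) p all (∈-allFin i)

all-Fin-true⁺ : (p : Fin m → Bool) → (∀ i → p i ≡ true) → allL (allFin m) p ≡ true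
all-Fin-true⁺ {m} p all = allL-true⁺ (allFin m) p (λ {i} _ → all i)

any-Fin-true⁻ : (p : Fin m → Bool) → anyL (allFin m) p ≡ true → Σ (Fin m) λ i → p i ≡ true
any-Fin-true⁻ {m} p any with i , _ , pi ← anyL-true⁻ (allFin m) p any = i , pi

any-Fin-true⁺ : (p : Fin m → Bool) (i : Fin m) → p i ≡ true → anyL (allFin m) p ≡ true
any-Fin-true⁺ {m} p i pi = anyL-true⁺ (allFin m) p (∈-allFin i) pi

countL-filter : (xs : List A) (p : A → Bool) → countL xs p ≡ length (filter (T? ∘ p) xs)
countL-filter []       p = refl
countL-filter (x ∷ xs) p with p x
... | true  = cong suc (countL-filter xs p)
... | false = countL-filter xs p

∈-filterB⁻ : ∀ {p : A → Bool} {xs x} → x ∈ filter (T? ∘ p) xs → x ∈ xs × p x ≡ true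
∈-filterB⁻ {p = p} m with x∈xs , px ← ∈-filter⁻ (T? ∘ p) m = x∈xs , Equivalence.to T-≡ px

∈-filterB⁺ : ∀ {p : A → Bool} {xs x} → x ∈ xs → p x ≡ true → x ∈ filter (T? ∘ p) xs
∈-filterB⁺ {p = p} x∈xs px = ∈-filter⁺ (T? ∘ p) x∈xs (Equivalence.from T-≡ px)

∈-─⁺ : ∀ {xs : List A} {x y} (y∈xs : y ∈ xs) → x ∈ xs → x ≢ y → x ∈ (xs ─ y∈xs)
∈-─⁺ (here refl) (here refl) x≢y = ⊥-elim (x≢y refl)
∈-─⁺ (here refl) (there x∈xs) x≢y = x∈xs
∈-─⁺ {xs = _ ∷ _ ∷ _} (there y∈xs) (here refl) x≢y = here refl
∈-─⁺ {xs = _ ∷ _ ∷ _} (there y∈xs) (there x∈xs) x≢y = there (∈-─⁺ y∈xs x∈xs x≢y)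

Unique-length-≤ : ∀ {xs ys : List A} → Unique xs → xs ⊆ ys → length xs ≤ length ys
Unique-length-≤ []                         xs⊆ys = z≤n
Unique-length-≤ {xs = x ∷ xs} {ys} (x≢xs ∷ !xs) xs⊆ys =
  let x∈ys = xs⊆ys (here refl) in
  subst (suc (length xs) ≤_) (sym (length-removeAt′ ys _))
    (s≤s (Unique-length-≤ !xs λ y∈xs → ∈-─⁺ x∈ys (xs⊆ys (there y∈xs)) (≢-head x≢xs y∈xs)))
  where
  ≢-head : ∀ {x y} {xs : List A} → All (x ≢_) xs → y ∈ xs → y ≢ x
  ≢-head (x≢y ∷ _)   (here refl) = x≢y ∘ sym
  ≢-head (_ ∷ x≢xs)  (there y∈xs) = ≢-head x≢xs y∈xs

Unique-map⁺-injectiveOn : (f : A → B) {xs : List A} →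
  (∀ {x y} → x ∈ xs → y ∈ xs → f x ≡ f y → x ≡ y) → Unique xs → Unique (map f xs)
Unique-map⁺-injectiveOn f inj []              = []
Unique-map⁺-injectiveOn f inj (x≢xs ∷ !xs) =
  images x≢xs (λ y∈xs → inj (here refl) (there y∈xs)) ∷ Unique-map⁺-injectiveOn f (λ p q → inj (there p) (there q)) !xs
  where
  images : ∀ {x} {ys : List _} → All (x ≢_) ys → (∀ {y} → y ∈ ys → f x ≡ f y → x ≡ y) → All (f x ≢_) (map f ys)
  images []            inj′ = []
  images (x≢y ∷ x≢ys) inj′ = (x≢y ∘ inj′ (here refl)) ∷ images x≢ys (inj′ ∘ there)

countL-≤-injection : {xs : List A} {ys : List B} {p : A → Bool} {q : B → Bool} (f : A → B) →
  Unique xs →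
  (∀ {x} → x ∈ xs → p x ≡ true → f x ∈ ys × q (f x) ≡ true) →
  (∀ {x y} → x ∈ xs → y ∈ xs → p x ≡ true → p y ≡ true → f x ≡ f y → x ≡ y) →
  countL xs p ≤ countL ys q
countL-≤-injection {xs = xs} {ys} {p} {q} f !xs into inj = begin
  countL xs p                                ≡⟨ countL-filter xs p ⟩
  length (filter (T? ∘ p) xs)                ≡⟨ length-map f (filter (T? ∘ p) xs) ⟨
  length (map f (filter (T? ∘ p) xs))        ≤⟨ Unique-length-≤ !image image⊆ ⟩
  length (filter (T? ∘ q) ys)                ≡⟨ countL-filter ys q ⟨
  countL ys q                                ∎
  where
  open ≤-Reasoning
  !image : Unique (map f (filter (T? ∘ p) xs))
  !image = Unique-map⁺-injectiveOn f
    (λ x∈ y∈ → let x∈xs , px = ∈-filterB⁻ x∈ ; y∈xs , py = ∈-filterB⁻ y∈ in inj x∈xs y∈xs px py)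
    (Uniqueₚ.filter⁺ (T? ∘ p) !xs)
  image⊆ : map f (filter (T? ∘ p) xs) ⊆ filter (T? ∘ q) ys
  image⊆ fx∈ with x , x∈ , refl ← ∈-map⁻ f fx∈ =
    let x∈xs , px = ∈-filterB⁻ x∈ ; fx∈ys , qfx = into x∈xs px in ∈-filterB⁺ fx∈ys qfx

countL-cong : (xs : List A) {p q : A → Bool} → (∀ {x} → x ∈ xs → p x ≡ q x) → countL xs p ≡ countL xs q
countL-cong []       p≗q = refl
countL-cong (x ∷ xs) {p} {q} p≗q rewrite p≗q (here refl) with q x
... | true  = cong suc (countL-cong xs (p≗q ∘ there))
... | false = countL-cong xs (p≗q ∘ there)

countL-mono : (xs : List A) {p q : A → Bool} → (∀ {x} → x ∈ xs → p x ≡ true → q x ≡ true) →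
  countL xs p ≤ countL xs q
countL-mono []       p⇒q = z≤n
countL-mono (x ∷ xs) {p} {q} p⇒q with p x in px | q x in qx
... | true  | true  = s≤s (countL-mono xs (p⇒q ∘ there))
... | false | true  = m≤n⇒m≤1+n (countL-mono xs (p⇒q ∘ there))
... | false | false = countL-mono xs (p⇒q ∘ there)
... | true  | false with () ← trans (sym (p⇒q (here refl) px)) qx

countL≤length : (xs : List A) (p : A → Bool) → countL xs p ≤ length xs
countL≤length []       p = z≤n
countL≤length (x ∷ xs) p with p x
... | true  = s≤s (countL≤length xs p)
... | false = m≤n⇒m≤1+n (countL≤length xs p)

countL<length : {xs : List A} (p : A → Bool) {x : A} → x ∈ xs → p x ≡ false → suc (countL xs p) ≤ length xs
countL<length {xs = _ ∷ xs} p (here refl) px rewrite px = s≤s (countL≤length xs p)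
countL<length {xs = y ∷ _}  p (there x∈xs) px with p y
... | true  = s≤s (countL<length p x∈xs px)
... | false = m≤n⇒m≤1+n (countL<length p x∈xs px)

countL-const-true : (xs : List A) → countL xs (λ _ → true) ≡ length xs
countL-const-true []       = refl
countL-const-true (x ∷ xs) = cong suc (countL-const-true xs)

countL-positive : {xs : List A} (p : A → Bool) {x : A} → x ∈ xs → p x ≡ true → 1 ≤ countL xs p
countL-positive {xs = _ ∷ _}  p (here refl) px rewrite px = s≤s z≤n
countL-positive {xs = y ∷ _}  p (there x∈xs) px with p y
... | true  = s≤s z≤n
... | false = countL-positive p x∈xs px

countL-++ : (xs ys : List A) (p : A → Bool) → countL (xs ++ ys) p ≡ countL xs p + countL ys p
countL-++ []       ys p = refl
countL-++ (x ∷ xs) ys p with p x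
... | true  = cong suc (countL-++ xs ys p)
... | false = countL-++ xs ys p

countL-map : (f : A → B) (xs : List A) (p : B → Bool) → countL (map f xs) p ≡ countL xs (p ∘ f)
countL-map f []       p = refl
countL-map f (x ∷ xs) p with p (f x)
... | true  = cong suc (countL-map f xs p)
... | false = countL-map f xs p

countL-split : (xs : List A) (p q : A → Bool) →
  countL xs p ≡ countL xs (λ x → p x ∧ q x) + countL xs (λ x → p x ∧ not (q x))
countL-split []       p q = refl
countL-split (x ∷ xs) p q with p x | q x
... | true  | true  = cong suc (countL-split xs p q)
... | true  | false = trans (cong suc (countL-split xs p q)) (sym (+-suc _ _))
... | false | _     = countL-split xs p q

_∧ᵈ_ : (A → Bool) → (A → B → Bool) → A × B → Bool
(p ∧ᵈ q) (x , y) = p x ∧ q x y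

fibre : (ys : List B) (p : A → Bool) (q : A → B → Bool) → A → ℕ
fibre ys p q x = if p x then countL ys (q x) else 0

countL-cartesianProduct-∷ : (x : A) (xs : List A) (ys : List B) (p : A → Bool) (q : A → B → Bool) →
  countL (cartesianProduct (x ∷ xs) ys) (p ∧ᵈ q) ≡ fibre ys p q x + countL (cartesianProduct xs ys) (p ∧ᵈ q)
countL-cartesianProduct-∷ x xs ys p q = begin
  countL (map (x ,_) ys ++ cartesianProduct xs ys) (p ∧ᵈ q)
    ≡⟨ countL-++ (map (x ,_) ys) _ (p ∧ᵈ q) ⟩
  countL (map (x ,_) ys) (p ∧ᵈ q) + countL (cartesianProduct xs ys) (p ∧ᵈ q)
    ≡⟨ cong (_+ _) (trans (countL-map (x ,_) ys (p ∧ᵈ q)) (row (p x))) ⟩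
  fibre ys p q x + countL (cartesianProduct xs ys) (p ∧ᵈ q) ∎
  where
  open ≡-Reasoning
  row : (b : Bool) → countL ys (λ y → b ∧ q x y) ≡ (if b then countL ys (q x) else 0)
  row true  = refl
  row false = trans (countL-cong ys λ _ → refl) (countL-const-false ys)
    where
    countL-const-false : (zs : List B) → countL zs (λ _ → false) ≡ 0
    countL-const-false []       = refl
    countL-const-false (_ ∷ zs) = countL-const-false zs

countL-cartesianProduct-≥ : (xs : List A) (ys : List B) (p : A → Bool) (q : A → B → Bool) (c : ℕ) →
  (∀ x → p x ≡ true → c ≤ countL ys (q x)) →
  c * countL xs p ≤ countL (cartesianProduct xs ys) (p ∧ᵈ q)
countL-cartesianProduct-≥ []       ys p q c bound = ≤-reflexive (*-zeroʳ c)
countL-cartesianProduct-≥ (x ∷ xs) ys p q c bound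
  rewrite countL-cartesianProduct-∷ x xs ys p q with p x in px
... | true  = ≤-trans (≤-reflexive (*-suc c (countL xs p)))
                (+-mono-≤ (bound x px) (countL-cartesianProduct-≥ xs ys p q c bound))
... | false = countL-cartesianProduct-≥ xs ys p q c bound

countL-cartesianProduct-≤ : (xs : List A) (ys : List B) (p : A → Bool) (q : A → B → Bool) (c : ℕ) →
  (∀ x → p x ≡ true → countL ys (q x) ≤ c) →
  countL (cartesianProduct xs ys) (p ∧ᵈ q) ≤ c * countL xs p
countL-cartesianProduct-≤ []       ys p q c bound = ≤-reflexive (sym (*-zeroʳ c))
countL-cartesianProduct-≤ (x ∷ xs) ys p q c bound
  rewrite countL-cartesianProduct-∷ x xs ys p q with p x in px
... | true  = ≤-trans (+-mono-≤ (bound x px) (countL-cartesianProduct-≤ xs ys p q c bound))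
                (≤-reflexive (sym (*-suc c (countL xs p))))
... | false = countL-cartesianProduct-≤ xs ys p q c bound

countL-∧-member : {xs ys : List A} (p r : A → Bool) → Unique xs → Unique ys → ys ⊆ xs →
  (∀ {x} → r x ≡ true → x ∈ ys) → (∀ {y} → y ∈ ys → r y ≡ true) →
  countL xs (λ x → p x ∧ r x) ≡ countL ys p
countL-∧-member p r !xs !ys ys⊆xs r⇒∈ ∈⇒r = ≤-antisym
  (countL-≤-injection (λ x → x) !xs
    (λ _ pr → let px , rx = ∧-true⁻ pr in r⇒∈ rx , px) (λ _ _ _ _ eq → eq))
  (countL-≤-injection (λ x → x) !ys
    (λ y∈ys py → ys⊆xs y∈ys , ∧-true⁺ py (∈⇒r y∈ys)) (λ _ _ _ _ eq → eq))

concatMap-map≡cartesianProductWith : {C : Set} (f : A → B → C) (xs : List A) (ys : List B) →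
  concatMap (λ x → map (f x) ys) xs ≡ cartesianProductWith f xs ys
concatMap-map≡cartesianProductWith f []       ys = refl
concatMap-map≡cartesianProductWith f (x ∷ xs) ys =
  cong (map (f x) ys ++_) (concatMap-map≡cartesianProductWith f xs ys)

vecsOf-unique : {xs : List A} → Unique xs → ∀ k → Unique (vecsOf xs k)
vecsOf-unique !xs zero    = [] ∷ []
vecsOf-unique {xs = xs} !xs (suc k) =
  subst Unique (sym (concatMap-map≡cartesianProductWith Vec._∷_ xs (vecsOf xs k)))
    (Uniqueₚ.cartesianProductWith⁺ Vec._∷_ Vecₚ.∷-injective !xs (vecsOf-unique !xs k))

∈-vecsOf : {xs : List A} → (∀ x → x ∈ xs) → ∀ {k} (v : Vec A k) → v ∈ vecsOf xs k
∈-vecsOf all Vec.[]                  = here refl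
∈-vecsOf {xs = xs} all (x Vec.∷ v) =
  subst (x Vec.∷ v ∈_) (sym (concatMap-map≡cartesianProductWith Vec._∷_ xs (vecsOf xs _)))
    (∈-cartesianProductWith⁺ Vec._∷_ (all x) (∈-vecsOf all v))

vectors : (m k : ℕ) → List (Vec (Fin m) k)
vectors m k = vecsOf (allFin m) k

vectors-unique : ∀ m k → Unique (vectors m k)
vectors-unique m = vecsOf-unique (Uniqueₚ.allFin⁺ m)

∈-vectors : ∀ {m k} (v : Vec (Fin m) k) → v ∈ vectors m k
∈-vectors = ∈-vecsOf ∈-allFin

bools-unique : Unique bools
bools-unique = ((λ ()) ∷ []) ∷ [] ∷ []

∈-bools : ∀ b → b ∈ bools
∈-bools false = here refl
∈-bools true  = there (here refl)

allSubData≡cartesianProduct : ∀ m →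
  allSubData m ≡ cartesianProduct (vecsOf bools m) (vecsOf (vecsOf bools m) m)
allSubData≡cartesianProduct m =
  concatMap-map≡cartesianProductWith _,_ (vecsOf bools m) (vecsOf (vecsOf bools m) m)

allSubData-unique : ∀ m → Unique (allSubData m)
allSubData-unique m = subst Unique (sym (allSubData≡cartesianProduct m))
  (Uniqueₚ.cartesianProduct⁺ (vecsOf-unique bools-unique m)
                             (vecsOf-unique (vecsOf-unique bools-unique m) m))

∈-allSubData : ∀ {m} (H : SubData m) → H ∈ allSubData m
∈-allSubData {m} (vs , es) = subst ((vs , es) ∈_) (sym (allSubData≡cartesianProduct m))
  (∈-cartesianProduct⁺ (∈-vecsOf ∈-bools vs) (∈-vecsOf (∈-vecsOf ∈-bools) es))

lookup-ext : ∀ {k} {u v : Vec A k} → (∀ i → lookup u i ≡ lookup v i) → u ≡ v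
lookup-ext {u = u} {v} u≗v = begin
  u                    ≡⟨ Vecₚ.tabulate∘lookup u ⟨
  tabulate (lookup u)  ≡⟨ Vecₚ.tabulate-cong u≗v ⟩
  tabulate (lookup v)  ≡⟨ Vecₚ.tabulate∘lookup v ⟩
  v                    ∎
  where open ≡-Reasoning

length-allFin : ∀ m → length (allFin m) ≡ m
length-allFin m = length-tabulate {n = m} (λ i → i)

firstL : (A → Bool) → A → List A → A
firstL p d []       = d
firstL p d (x ∷ xs) = if p x then x else firstL p d xs

firstL-satisfies : (p : A → Bool) (d : A) (xs : List A) → anyL xs p ≡ true → p (firstL p d xs) ≡ true
firstL-satisfies p d (x ∷ xs) any with p x in px
... | true  = px
... | false = firstL-satisfies p d xs any

record IsEmbedding (F X : Graph) (φ : Vec (Fin (n X)) (n F)) : Set where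
  field
    injective : ∀ i j → lookup φ i ≡ lookup φ j → i ≡ j
    adj-preserving : ∀ i j → adj F i j ≡ true → adj X (lookup φ i) (lookup φ j) ≡ true

isInjective : ∀ {k} → Vec (Fin m) k → Bool
isInjective {k = k} φ =
  allL (allFin k) λ i → allL (allFin k) λ j → not (i == j) ⇒b not (lookup φ i == lookup φ j)

isInjective-true⁻ : ∀ {k} (φ : Vec (Fin m) k) → isInjective φ ≡ true →
  ∀ i j → lookup φ i ≡ lookup φ j → i ≡ j
isInjective-true⁻ φ inj i j φi≡φj with i Finₚ.≟ j
... | yes i≡j = i≡j
... | no  i≢j with () ← trans (sym (==-true⁺ φi≡φj))
  (not-true⁻ (⇒b-true⁻ (all-Fin-true⁻ _ (all-Fin-true⁻ _ inj i) j) (not-true⁺ (==-false⁺ i≢j))))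

isInjective-true⁺ : ∀ {k} (φ : Vec (Fin m) k) → (∀ i j → lookup φ i ≡ lookup φ j → i ≡ j) →
  isInjective φ ≡ true
isInjective-true⁺ φ inj = all-Fin-true⁺ _ λ i → all-Fin-true⁺ _ λ j → ⇒b-true⁺ λ i≢j →
  not-true⁺ (==-false⁺ λ φi≡φj → true≢false (trans (sym (==-true⁺ (inj i j φi≡φj))) (not-true⁻ i≢j)))

isAdjPreserving : (F X : Graph) → Vec (Fin (n X)) (n F) → Bool
isAdjPreserving F X φ =
  allL (allFin (n F)) λ i → allL (allFin (n F)) λ j → adj F i j ⇒b adj X (lookup φ i) (lookup φ j)

isEmbedding : (F X : Graph) → Vec (Fin (n X)) (n F) → Bool
isEmbedding F X φ = isInjective φ ∧ isAdjPreserving F X φ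

isEmbedding-true⁻ : ∀ F X φ → isEmbedding F X φ ≡ true → IsEmbedding F X φ
isEmbedding-true⁻ F X φ emb with inj , hom ← ∧-true⁻ emb = record
  { injective      = isInjective-true⁻ φ inj
  ; adj-preserving = λ i j → ⇒b-true⁻ (all-Fin-true⁻ _ (all-Fin-true⁻ _ hom i) j)
  }

isEmbedding-true⁺ : ∀ F X φ → IsEmbedding F X φ → isEmbedding F X φ ≡ true
isEmbedding-true⁺ F X φ emb = ∧-true⁺ (isInjective-true⁺ φ injective)
  (all-Fin-true⁺ _ λ i → all-Fin-true⁺ _ λ j → ⇒b-true⁺ (adj-preserving i j))
  where open IsEmbedding emb

#embeddings : (F X : Graph) → ℕ
#embeddings F X = countL (vectors (n X) (n F)) (isEmbedding F X)

punchIn′ : Fin m → Fin (pred m) → Fin m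
punchIn′ {suc m} = punchIn

deleteVertex : (F : Graph) → Fin (n F) → Graph
deleteVertex F v = record
  { n      = pred (n F)
  ; adj    = λ i j → adj F (punchIn′ v i) (punchIn′ v j)
  ; sym    = λ i j → Graph.sym F (punchIn′ v i) (punchIn′ v j)
  ; irrefl = λ i → Graph.irrefl F (punchIn′ v i)
  }

HasCycle-deleteVertex : (F : Graph) (v : Fin (n F)) → HasCycle (deleteVertex F v) → HasCycle F
HasCycle-deleteVertex record { n = suc k } v (ℓ , c , c-inj , c-adj , c-close) =
  ℓ , punchIn v ∘ c , c-inj ∘ Finₚ.punchIn-injective v _ _ , c-adj , c-close

IsForest-deleteVertex : (F : Graph) (v : Fin (n F)) → IsForest F → IsForest (deleteVertex F v)
IsForest-deleteVertex F v forest = forest ∘ HasCycle-deleteVertex F v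

inImage : ∀ {k} → Vec (Fin m) k → Fin m → Bool
inImage {k = k} φ u = anyL (allFin k) λ i → lookup φ i == u

inImage-true⁻ : ∀ {k} (φ : Vec (Fin m) k) {u} → inImage φ u ≡ true → Σ (Fin k) λ i → lookup φ i ≡ u
inImage-true⁻ φ u∈ with i , φi==u ← any-Fin-true⁻ _ u∈ = i , ==-true⁻ φi==u

inImage-lookup : ∀ {k} (φ : Vec (Fin m) k) i → inImage φ (lookup φ i) ≡ true
inImage-lookup φ i = any-Fin-true⁺ _ i (==-true⁺ refl)

image : ∀ {k} → Vec (Fin m) k → List (Fin m)
image {k = k} φ = map (lookup φ) (allFin k)

length-image : ∀ {k} (φ : Vec (Fin m) k) → length (image φ) ≡ k
length-image {k = k} φ = trans (length-map (lookup φ) (allFin k)) (length-allFin k)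

module _ {k} (φ : Vec (Fin m) k) (φ-inj : ∀ i j → lookup φ i ≡ lookup φ j → i ≡ j) where

  countL-∧-inImage : (p : Fin m → Bool) → countL (allFin m) (λ u → p u ∧ inImage φ u) ≡ countL (image φ) p
  countL-∧-inImage p = countL-∧-member p (inImage φ) (Uniqueₚ.allFin⁺ m)
    (Uniqueₚ.map⁺ (φ-inj _ _) (Uniqueₚ.allFin⁺ k)) (λ _ → ∈-allFin _)
    (λ u∈ → let i , φi≡u = inImage-true⁻ φ u∈ in subst (_∈ image φ) φi≡u (∈-map⁺ (lookup φ) (∈-allFin i)))
    (λ u∈ → let i , _ , u≡φi = ∈-map⁻ (lookup φ) u∈ in subst (λ w → inImage φ w ≡ true) (sym u≡φi) (inImage-lookup φ i))

  countL-outsideImage : (p : Fin m → Bool) →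
    countL (allFin m) (λ u → p u ∧ not (inImage φ u)) + countL (image φ) p ≡ countL (allFin m) p
  countL-outsideImage p = begin
    outside + countL (image φ) p                                ≡⟨ +-comm outside (countL (image φ) p) ⟩
    countL (image φ) p + outside                                ≡⟨ cong (_+ outside) (countL-∧-inImage p) ⟨
    countL (allFin m) (λ u → p u ∧ inImage φ u) + outside       ≡⟨ countL-split (allFin m) p (inImage φ) ⟨
    countL (allFin m) p                                         ∎
    where
    open ≡-Reasoning
    outside = countL (allFin m) (λ u → p u ∧ not (inImage φ u))

  #outsideImage : countL (allFin m) (λ u → not (inImage φ u)) ≡ m ∸ k
  #outsideImage = begin
    outside                                       ≡⟨ m+n∸n≡m outside k ⟨
    outside + k ∸ k                               ≡⟨ cong (λ t → outside + t ∸ k) #image ⟨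
    outside + countL (image φ) (λ _ → true) ∸ k   ≡⟨ cong (_∸ k) (countL-outsideImage (λ _ → true)) ⟩
    countL (allFin m) (λ _ → true) ∸ k            ≡⟨ cong (_∸ k) (trans (countL-const-true (allFin m)) (length-allFin m)) ⟩
    m ∸ k                                         ∎
    where
    open ≡-Reasoning
    outside = countL (allFin m) (λ u → not (inImage φ u))
    #image : countL (image φ) (λ _ → true) ≡ k
    #image = trans (countL-const-true (image φ)) (length-image φ)

-- The image vertex w is not its own neighbour, so at most k − 1 of its ≥ d neighbours are in the image.
#neighboursOutsideImage-≥ : (X : Graph) {d k : ℕ} → MinDegreeAtLeast X d →
  (φ : Vec (Fin (n X)) k) → (∀ i j → lookup φ i ≡ lookup φ j → i ≡ j) → (j : Fin k) →
  suc d ∸ k ≤ countL (allFin (n X)) (λ u → adj X (lookup φ j) u ∧ not (inImage φ u))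
#neighboursOutsideImage-≥ X {d} {k} δ φ φ-inj j = begin
  suc d ∸ k                  ≤⟨ ∸-monoʳ-≤ (suc d) inside<k ⟩
  d ∸ inside                 ≤⟨ ∸-monoˡ-≤ inside (subst (d ≤_) (sym split) (δ w)) ⟩
  outside + inside ∸ inside  ≡⟨ m+n∸n≡m outside inside ⟩
  outside                    ∎
  where
  open ≤-Reasoning
  w = lookup φ j
  outside = countL (allFin (n X)) (λ u → adj X w u ∧ not (inImage φ u))
  inside  = countL (image φ) (adj X w)
  split : outside + inside ≡ degree X w
  split = countL-outsideImage φ φ-inj (adj X w)
  inside<k : suc inside ≤ k
  inside<k = subst (suc inside ≤_) (length-image φ)
    (countL<length (adj X w) (∈-map⁺ (lookup φ) (∈-allFin j)) (Graph.irrefl X w))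

AtMostOneNeighbour : (F : Graph) → Fin (n F) → Set
AtMostOneNeighbour F v = ∀ i j → adj F v i ≡ true → adj F v j ≡ true → i ≡ j

vertexOrPunchIn : ∀ {k} (v i : Fin (suc k)) → i ≡ v ⊎ Σ (Fin k) λ i′ → i ≡ punchIn v i′
vertexOrPunchIn v i with i Finₚ.≟ v
... | yes i≡v = inj₁ i≡v
... | no  i≢v = inj₂ (punchOut (i≢v ∘ sym) , sym (Finₚ.punchIn-punchOut (i≢v ∘ sym)))

-- F is given by its fields, so that n F is syntactically suc k and removeAt/insertAt at v typecheck.
module OneVertexExtension {k : ℕ} (adjF : Fin (suc k) → Fin (suc k) → Bool)
  (symF : ∀ i j → adjF i j ≡ adjF j i) (irreflF : ∀ i → adjF i i ≡ false)
  (v : Fin (suc k)) (X : Graph) where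

  F : Graph
  F = record { n = suc k ; adj = adjF ; sym = symF ; irrefl = irreflF }

  F−v : Graph
  F−v = deleteVertex F v

  isExtensionVertex : Vec (Fin (n X)) k → Fin (n X) → Bool
  isExtensionVertex φ′ u =
    not (inImage φ′ u) ∧ allL (allFin k) λ j → adjF v (punchIn v j) ⇒b adj X u (lookup φ′ j)

  lookup-removeAt : (φ : Vec (Fin (n X)) (suc k)) (j : Fin k) →
    lookup (removeAt φ v) j ≡ lookup φ (punchIn v j)
  lookup-removeAt φ j = begin
    lookup (removeAt φ v) j                                     ≡⟨ Vecₚ.insertAt-punchIn (removeAt φ v) v _ j ⟨
    lookup (insertAt (removeAt φ v) v (lookup φ v)) (punchIn v j) ≡⟨ cong (λ ψ → lookup ψ (punchIn v j)) (Vecₚ.insertAt-removeAt φ v) ⟩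
    lookup φ (punchIn v j)                                      ∎
    where open ≡-Reasoning

  removeAt-embedding : ∀ φ → IsEmbedding F X φ → IsEmbedding F−v X (removeAt φ v)
  removeAt-embedding φ emb = record
    { injective      = λ i j eq → Finₚ.punchIn-injective v i j
        (injective _ _ (trans (sym (lookup-removeAt φ i)) (trans eq (lookup-removeAt φ j))))
    ; adj-preserving = λ i j ij → subst₂ (λ x y → adj X x y ≡ true)
        (sym (lookup-removeAt φ i)) (sym (lookup-removeAt φ j)) (adj-preserving _ _ ij)
    }
    where open IsEmbedding emb

  removeAt-extensionVertex : ∀ φ → IsEmbedding F X φ → isExtensionVertex (removeAt φ v) (lookup φ v) ≡ true
  removeAt-extensionVertex φ emb = ∧-true⁺ (not-true⁺ outside) (all-Fin-true⁺ _ λ j → ⇒b-true⁺ λ vj →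
    subst (λ w → adj X (lookup φ v) w ≡ true) (sym (lookup-removeAt φ j)) (adj-preserving v (punchIn v j) vj))
    where
    open IsEmbedding emb
    outside : inImage (removeAt φ v) (lookup φ v) ≡ false
    outside with inImage (removeAt φ v) (lookup φ v) in eq
    ... | false = refl
    ... | true with j , φj≡φv ← inImage-true⁻ (removeAt φ v) eq =
      ⊥-elim (Finₚ.punchInᵢ≢i v j (injective _ _ (trans (sym (lookup-removeAt φ j)) φj≡φv)))

  insertAt-embedding : ∀ φ′ u → IsEmbedding F−v X φ′ → isExtensionVertex φ′ u ≡ true →
    IsEmbedding F X (insertAt φ′ v u)
  insertAt-embedding φ′ u emb ext = record { injective = inj ; adj-preserving = hom }
    where
    open IsEmbedding emb
    ψ = insertAt φ′ v u
    outside : inImage φ′ u ≡ false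
    outside = not-true⁻ (proj₁ (∧-true⁻ ext))
    toNeighbours : ∀ j → adjF v (punchIn v j) ≡ true → adj X u (lookup φ′ j) ≡ true
    toNeighbours j = ⇒b-true⁻ (all-Fin-true⁻ _ (proj₂ (∧-true⁻ {not (inImage φ′ u)} ext)) j)
    ψv : lookup ψ v ≡ u
    ψv = Vecₚ.insertAt-lookup φ′ v u
    ψpunchIn : ∀ j → lookup ψ (punchIn v j) ≡ lookup φ′ j
    ψpunchIn j = Vecₚ.insertAt-punchIn φ′ v u j
    φ′≢u : ∀ j → lookup ψ (punchIn v j) ≢ u
    φ′≢u j eq = true≢false (trans (sym (inImage-lookup φ′ j)) (subst (λ w → inImage φ′ w ≡ false)
                  (sym (trans (sym (ψpunchIn j)) eq)) outside))
    inj : ∀ i j → lookup ψ i ≡ lookup ψ j → i ≡ j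
    inj i j eq with vertexOrPunchIn v i | vertexOrPunchIn v j
    ... | inj₁ refl         | inj₁ refl         = refl
    ... | inj₁ refl         | inj₂ (j′ , refl) = ⊥-elim (φ′≢u j′ (trans (sym eq) ψv))
    ... | inj₂ (i′ , refl) | inj₁ refl         = ⊥-elim (φ′≢u i′ (trans eq ψv))
    ... | inj₂ (i′ , refl) | inj₂ (j′ , refl) =
      cong (punchIn v) (injective i′ j′ (trans (sym (ψpunchIn i′)) (trans eq (ψpunchIn j′))))
    hom : ∀ i j → adjF i j ≡ true → adj X (lookup ψ i) (lookup ψ j) ≡ true
    hom i j ij with vertexOrPunchIn v i | vertexOrPunchIn v j
    ... | inj₁ refl         | inj₁ refl         with () ← trans (sym ij) (irreflF i)
    ... | inj₁ refl         | inj₂ (j′ , refl) =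
      subst₂ (λ x y → adj X x y ≡ true) (sym ψv) (sym (ψpunchIn j′)) (toNeighbours j′ ij)
    ... | inj₂ (i′ , refl) | inj₁ refl         =
      subst₂ (λ x y → adj X x y ≡ true) (sym (ψpunchIn i′)) (sym ψv)
        (trans (Graph.sym X _ _) (toNeighbours i′ (trans (symF _ _) ij)))
    ... | inj₂ (i′ , refl) | inj₂ (j′ , refl) =
      subst₂ (λ x y → adj X x y ≡ true) (sym (ψpunchIn i′)) (sym (ψpunchIn j′)) (adj-preserving i′ j′ ij)

  extensionPairs : List (Vec (Fin (n X)) k × Fin (n X))
  extensionPairs = cartesianProduct (vectors (n X) k) (allFin (n X))

  #embeddings-extension : #embeddings F X ≡ countL extensionPairs (isEmbedding F−v X ∧ᵈ isExtensionVertex)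
  #embeddings-extension = ≤-antisym
    (countL-≤-injection (λ φ → removeAt φ v , lookup φ v) (vectors-unique (n X) (suc k))
      (λ {φ} _ emb → let emb′ = isEmbedding-true⁻ F X φ emb in
        ∈-cartesianProduct⁺ (∈-vectors _) (∈-allFin _) ,
        ∧-true⁺ (isEmbedding-true⁺ F−v X _ (removeAt-embedding φ emb′)) (removeAt-extensionVertex φ emb′))
      (λ {φ} {ψ} _ _ _ _ eq → begin
        φ                                               ≡⟨ Vecₚ.insertAt-removeAt φ v ⟨
        insertAt (removeAt φ v) v (lookup φ v)          ≡⟨ cong (λ (φ′ , u) → insertAt φ′ v u) eq ⟩
        insertAt (removeAt ψ v) v (lookup ψ v)          ≡⟨ Vecₚ.insertAt-removeAt ψ v ⟩
        ψ                                               ∎))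
    (countL-≤-injection (λ (φ′ , u) → insertAt φ′ v u)
      (Uniqueₚ.cartesianProduct⁺ (vectors-unique (n X) k) (Uniqueₚ.allFin⁺ (n X)))
      (λ {(φ′ , u)} _ pair → let emb , ext = ∧-true⁻ pair in
        ∈-vectors _ , isEmbedding-true⁺ F X _ (insertAt-embedding φ′ u (isEmbedding-true⁻ F−v X φ′ emb) ext))
      (λ {(φ′ , u)} {(ψ′ , w)} _ _ _ _ eq → cong₂ _,_
        (trans (sym (Vecₚ.removeAt-insertAt φ′ v u)) (trans (cong (λ ψ → removeAt ψ v) eq) (Vecₚ.removeAt-insertAt ψ′ v w)))
        (trans (sym (Vecₚ.insertAt-lookup φ′ v u)) (trans (cong (λ ψ → lookup ψ v) eq) (Vecₚ.insertAt-lookup ψ′ v w)))))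
    where open ≡-Reasoning

  #embeddings-≤ : (c : ℕ) → (∀ φ′ → IsEmbedding F−v X φ′ → countL (allFin (n X)) (isExtensionVertex φ′) ≤ c) →
    #embeddings F X ≤ c * #embeddings F−v X
  #embeddings-≤ c bound = ≤-trans (≤-reflexive #embeddings-extension)
    (countL-cartesianProduct-≤ (vectors (n X) k) (allFin (n X)) (isEmbedding F−v X) isExtensionVertex c
      λ φ′ emb → bound φ′ (isEmbedding-true⁻ F−v X φ′ emb))

  #embeddings-≥ : (c : ℕ) → (∀ φ′ → IsEmbedding F−v X φ′ → c ≤ countL (allFin (n X)) (isExtensionVertex φ′)) →
    c * #embeddings F−v X ≤ #embeddings F X
  #embeddings-≥ c bound = ≤-trans
    (countL-cartesianProduct-≥ (vectors (n X) k) (allFin (n X)) (isEmbedding F−v X) isExtensionVertex c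
      λ φ′ emb → bound φ′ (isEmbedding-true⁻ F−v X φ′ emb))
    (≤-reflexive (sym #embeddings-extension))

  #extensionVertices-≤ : ∀ φ′ → IsEmbedding F−v X φ′ → countL (allFin (n X)) (isExtensionVertex φ′) ≤ n X ∸ k
  #extensionVertices-≤ φ′ emb =
    subst (countL (allFin (n X)) (isExtensionVertex φ′) ≤_) (#outsideImage φ′ (IsEmbedding.injective emb))
      (countL-mono (allFin (n X)) λ _ ext → proj₁ (∧-true⁻ ext))

  #extensionVertices-≥ : ∀ {d} → MinDegreeAtLeast X d → suc d ≤ n X → AtMostOneNeighbour F v →
    ∀ φ′ → IsEmbedding F−v X φ′ → suc d ∸ k ≤ countL (allFin (n X)) (isExtensionVertex φ′)
  #extensionVertices-≥ {d} δ d<n leaf φ′ emb with Finₚ.any? (λ j → adjF v (punchIn v j) Bool.≟ true)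
  ... | no isolated = begin
    suc d ∸ k                                          ≤⟨ ∸-monoˡ-≤ k d<n ⟩
    n X ∸ k                                            ≡⟨ #outsideImage φ′ injective ⟨
    countL (allFin (n X)) (λ u → not (inImage φ′ u))  ≤⟨ countL-mono (allFin (n X)) (λ _ out →
                                                            ∧-true⁺ out (all-Fin-true⁺ _ λ j → ⇒b-true⁺ λ vj →
                                                              ⊥-elim (isolated (j , vj)))) ⟩
    countL (allFin (n X)) (isExtensionVertex φ′)      ∎
    where
    open ≤-Reasoning
    open IsEmbedding emb
  ... | yes (j₀ , vj₀) = ≤-trans (#neighboursOutsideImage-≥ X δ φ′ injective j₀)
    (countL-mono (allFin (n X)) λ {u} _ nbr → let wu , out = ∧-true⁻ nbr in
      ∧-true⁺ out (all-Fin-true⁺ _ λ j → ⇒b-true⁺ λ vj →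
        subst (λ i → adj X u (lookup φ′ i) ≡ true)
          (sym (Finₚ.punchIn-injective v j j₀ (leaf _ _ vj vj₀))) (trans (Graph.sym X _ _) wu)))
    where open IsEmbedding emb

inject≤-inject₁ : ∀ {m k} (s : Fin m) .(m≤k : m ≤ k) → inject≤ (inject₁ s) (s≤s m≤k) ≡ inject₁ (inject≤ s m≤k)
inject≤-inject₁ s m≤k = Finₚ.toℕ-injective (begin
  toℕ (inject≤ (inject₁ s) (s≤s m≤k)) ≡⟨ Finₚ.toℕ-inject≤ (inject₁ s) (s≤s m≤k) ⟩
  toℕ (inject₁ s)                     ≡⟨ Finₚ.toℕ-inject₁ s ⟩
  toℕ s                               ≡⟨ Finₚ.toℕ-inject≤ s m≤k ⟨
  toℕ (inject≤ s m≤k)                 ≡⟨ Finₚ.toℕ-inject₁ (inject≤ s m≤k) ⟨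
  toℕ (inject₁ (inject≤ s m≤k))       ∎)
  where open ≡-Reasoning

module _ (F : Graph) where

  atMostOneNeighbour-or-twoNeighbours : ∀ v →
    AtMostOneNeighbour F v ⊎ ∃₂ λ i j → adj F v i ≡ true × adj F v j ≡ true × i ≢ j
  atMostOneNeighbour-or-twoNeighbours v
    with Finₚ.any? (λ i → Finₚ.any? λ j → adj F v i Bool.≟ true ×-dec adj F v j Bool.≟ true ×-dec ¬? (i Finₚ.≟ j))
  ... | yes (i , j , two) = inj₂ (i , j , two)
  ... | no  ¬two = inj₁ λ i j vi vj → decidable-stable (i Finₚ.≟ j) λ i≢j → ¬two (i , j , vi , vj , i≢j)

  record Path (ℓ : ℕ) : Set where
    field
      vertex    : Fin (suc (suc ℓ)) → Fin (n F)
      injective : Injective _≡_ _≡_ vertex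
      adjacent  : ∀ t → adj F (vertex (inject₁ t)) (vertex (suc t)) ≡ true

  no-Path : ¬ Path (n F)
  no-Path P = <-irrefl refl (≤-trans (n≤1+n _) (Finₚ.injective⇒≤ (Path.injective P)))

  Path-chord⇒HasCycle : ∀ {ℓ} (P : Path ℓ) (t : Fin ℓ) →
    adj F (Path.vertex P (suc (suc t))) (Path.vertex P zero) ≡ true → HasCycle F
  Path-chord⇒HasCycle {ℓ} P t closing =
    toℕ t , vertex ∘ ι , Finₚ.inject≤-injective _ _ _ _ ∘ injective , along , close
    where
    open Path P
    t≤ℓ : suc (toℕ t) ≤ ℓ
    t≤ℓ = Finₚ.toℕ<n t
    ι : Fin (suc (suc (suc (toℕ t)))) → Fin (suc (suc ℓ))
    ι s = inject≤ s (s≤s (s≤s t≤ℓ))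
    along : ∀ s → adj F (vertex (ι (inject₁ s))) (vertex (ι (suc s))) ≡ true
    along s = subst (λ i → adj F (vertex i) (vertex (ι (suc s))) ≡ true)
      (sym (inject≤-inject₁ s (s≤s t≤ℓ))) (adjacent (inject≤ s (s≤s t≤ℓ)))
    ι-last : ι (fromℕ (suc (suc (toℕ t)))) ≡ suc (suc t)
    ι-last = Finₚ.toℕ-injective (trans (Finₚ.toℕ-inject≤ (fromℕ (suc (suc (toℕ t)))) (s≤s (s≤s t≤ℓ))) (Finₚ.toℕ-fromℕ _))
    close : adj F (vertex (ι (fromℕ (suc (suc (toℕ t)))))) (vertex zero) ≡ true
    close = subst (λ i → adj F (vertex i) (vertex zero) ≡ true) (sym ι-last) closing

  AtMostOneNeighbour? : ∀ v → Dec (AtMostOneNeighbour F v)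
  AtMostOneNeighbour? v with atMostOneNeighbour-or-twoNeighbours v
  ... | inj₁ leaf                        = yes leaf
  ... | inj₂ (i , j , vi , vj , i≢j) = no λ leaf → i≢j (leaf i j vi vj)

  -- Without a vertex of degree ≤ 1, a path can always be prolonged at its first vertex, either to a
  -- new vertex or back to a vertex at least two steps along it, closing a cycle.
  module _ (noLeaf : ∀ v → ¬ AtMostOneNeighbour F v) where

    neighbourOtherThan : ∀ w y → ∃ λ x → adj F w x ≡ true × x ≢ y
    neighbourOtherThan w y with atMostOneNeighbour-or-twoNeighbours w
    ... | inj₁ leaf = ⊥-elim (noLeaf w leaf)
    ... | inj₂ (i , j , wi , wj , i≢j) with i Finₚ.≟ y
    ...   | yes refl = j , wj , i≢j ∘ sym
    ...   | no  i≢y  = i , wi , i≢y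

    initialPath : Fin (n F) → Path 0
    initialPath v with x , vx , x≢v ← neighbourOtherThan v v = record
      { vertex = vertex ; injective = injective ; adjacent = λ { zero → trans (Graph.sym F x v) vx } }
      where
      vertex : Fin 2 → Fin (n F)
      vertex zero       = x
      vertex (suc zero) = v
      injective : Injective _≡_ _≡_ vertex
      injective {zero}     {zero}     _   = refl
      injective {zero}     {suc zero} x≡v = ⊥-elim (x≢v x≡v)
      injective {suc zero} {zero}     v≡x = ⊥-elim (x≢v (sym v≡x))
      injective {suc zero} {suc zero} _   = refl

    extendPath : ∀ {ℓ} → Path ℓ → Path (suc ℓ) ⊎ HasCycle F
    extendPath {ℓ} P with x , p₀x , x≢p₁ ← neighbourOtherThan (Path.vertex P zero) (Path.vertex P (suc zero))
                        | Finₚ.any? (λ t → Path.vertex P t Finₚ.≟ x)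
    ... | no x∉P = inj₁ record { vertex = vertex′ ; injective = injective′ ; adjacent = adjacent′ }
      where
      open Path P
      vertex′ : Fin (suc (suc (suc ℓ))) → Fin (n F)
      vertex′ zero    = x
      vertex′ (suc t) = vertex t
      injective′ : Injective _≡_ _≡_ vertex′
      injective′ {zero}  {zero}  _  = refl
      injective′ {zero}  {suc t} eq = ⊥-elim (x∉P (t , sym eq))
      injective′ {suc s} {zero}  eq = ⊥-elim (x∉P (s , eq))
      injective′ {suc s} {suc t} eq = cong suc (injective eq)
      adjacent′ : ∀ t → adj F (vertex′ (inject₁ t)) (vertex′ (suc t)) ≡ true
      adjacent′ zero    = trans (Graph.sym F x (vertex zero)) p₀x
      adjacent′ (suc t) = adjacent t
    ... | yes (zero , p₀≡x) with () ← trans (sym p₀x) (subst (λ y → adj F y x ≡ false) (sym p₀≡x) (Graph.irrefl F x))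
    ... | yes (suc zero , p₁≡x) = ⊥-elim (x≢p₁ (sym p₁≡x))
    ... | yes (suc (suc t) , pₜ≡x) = inj₂ (Path-chord⇒HasCycle P t
      (trans (cong (λ y → adj F y (Path.vertex P zero)) pₜ≡x) (trans (Graph.sym F x _) p₀x)))

    pathOrCycle : Fin (n F) → ∀ ℓ → Path ℓ ⊎ HasCycle F
    pathOrCycle v zero    = inj₁ (initialPath v)
    pathOrCycle v (suc ℓ) with pathOrCycle v ℓ
    ... | inj₁ P     = extendPath P
    ... | inj₂ cycle = inj₂ cycle

  nonemptyForest-atMostOneNeighbour : IsForest F → Fin (n F) → Σ (Fin (n F)) (AtMostOneNeighbour F)
  nonemptyForest-atMostOneNeighbour forest v with Finₚ.any? AtMostOneNeighbour?
  ... | yes leaf = leaf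
  ... | no  ¬leaf with pathOrCycle (λ w leaf → ¬leaf (w , leaf)) v (n F)
  ...   | inj₁ P     = ⊥-elim (no-Path P)
  ...   | inj₂ cycle = ⊥-elim (forest cycle)

-- The size of F is an explicit index of the recursion, which makes the step to deleteVertex F v structural.
#embeddings-K-≤ : ∀ d (F : Graph) → #embeddings F (K (suc d)) ≤ suc d P′ n F
#embeddings-K-≤ d F = go (n F) F refl
  where
  go : ∀ k (F : Graph) → n F ≡ k → #embeddings F (K (suc d)) ≤ suc d P′ k
  go zero    F@record { n = _ } refl = countL≤length (vectors (suc d) 0) (isEmbedding F (K (suc d)))
  go (suc k) F@record { n = _ ; adj = a ; sym = s ; irrefl = r } refl = begin
    #embeddings F (K (suc d))                  ≤⟨ #embeddings-≤ (suc d ∸ k) #extensionVertices-≤ ⟩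
    (suc d ∸ k) * #embeddings F−v (K (suc d))  ≤⟨ *-monoʳ-≤ (suc d ∸ k) (go k F−v refl) ⟩
    (suc d ∸ k) * (suc d P′ k)                 ∎
    where
    open ≤-Reasoning
    open OneVertexExtension a s r zero (K (suc d)) hiding (F)

#embeddings-forest-≥ : ∀ {d} (G : Graph) → MinDegreeAtLeast G d → suc d ≤ n G →
  (F : Graph) → IsForest F → suc d P′ n F ≤ #embeddings F G
#embeddings-forest-≥ {d} G δ d<n F = go (n F) F refl
  where
  go : ∀ k (F : Graph) → n F ≡ k → IsForest F → suc d P′ k ≤ #embeddings F G
  go zero    record { n = _ } refl forest = ≤-refl
  go (suc k) F@record { n = _ ; adj = a ; sym = s ; irrefl = r } refl forest = begin
    (suc d ∸ k) * (suc d P′ k)       ≤⟨ *-monoʳ-≤ (suc d ∸ k) (go k F−v refl (IsForest-deleteVertex F v forest)) ⟩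
    (suc d ∸ k) * #embeddings F−v G  ≤⟨ #embeddings-≥ (suc d ∸ k) (#extensionVertices-≥ δ d<n leaf) ⟩
    #embeddings F G                  ∎
    where
    open ≤-Reasoning
    leafOf-F = nonemptyForest-atMostOneNeighbour F forest zero
    v = proj₁ leafOf-F
    leaf = proj₂ leafOf-F
    open OneVertexExtension a s r v G hiding (F)

vertices : SubData m → Vec Bool m
vertices = proj₁

edge : SubData m → Fin m → Fin m → Bool
edge H u w = lookup (lookup (proj₂ H) u) w

record IsSubgraph (X : Graph) (H : SubData (n X)) : Set where
  field
    edge-sym   : ∀ u w → edge H u w ≡ true → edge H w u ≡ true
    edge-valid : ∀ u w → edge H u w ≡ true →
                 lookup (vertices H) u ≡ true × lookup (vertices H) w ≡ true × adj X u w ≡ true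

isSubgraph-true⁻ : ∀ X H → isSubgraph X H ≡ true → IsSubgraph X H
isSubgraph-true⁻ X H sub = record
  { edge-sym   = λ u w → ⇒b-true⁻ (proj₁ (∧-true⁻ (entry u w)))
  ; edge-valid = λ u w uw →
      let vu , rest = ∧-true⁻ (⇒b-true⁻ (proj₂ (∧-true⁻ {edge H u w ⇒b edge H w u} (entry u w))) uw)
          vw , xuw  = ∧-true⁻ rest
      in vu , vw , xuw
  }
  where entry = λ u w → all-Fin-true⁻ _ (all-Fin-true⁻ _ sub u) w

isSubgraph-true⁺ : ∀ X H → IsSubgraph X H → isSubgraph X H ≡ true
isSubgraph-true⁺ X H sub = all-Fin-true⁺ _ λ u → all-Fin-true⁺ _ λ w →
  ∧-true⁺ (⇒b-true⁺ (edge-sym u w)) (⇒b-true⁺ λ uw →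
    let vu , vw , xuw = edge-valid u w uw in ∧-true⁺ vu (∧-true⁺ vw xuw))
  where open IsSubgraph sub

record IsIsomorphism (F : Graph) (H : SubData m) (φ : Vec (Fin m) (n F)) : Set where
  field
    injective : ∀ i j → lookup φ i ≡ lookup φ j → i ≡ j
    into      : ∀ i → lookup (vertices H) (lookup φ i) ≡ true
    onto      : ∀ u → lookup (vertices H) u ≡ true → Σ (Fin (n F)) λ i → lookup φ i ≡ u
    edge-iff  : ∀ i j → edge H (lookup φ i) (lookup φ j) ≡ adj F i j

-- Definitionally the predicate searched for by isIsoTo, so isIsoTo F H is anyL (vectors m (n F)) (isIsomorphism F H).
isIsomorphism : (F : Graph) (H : SubData m) → Vec (Fin m) (n F) → Bool
isIsomorphism {m} F H φ =
  isInjective φ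
  ∧ (allL (allFin (n F)) λ i → lookup (vertices H) (lookup φ i))
  ∧ (allL (allFin m) λ u → lookup (vertices H) u ⇒b inImage φ u)
  ∧ (allL (allFin (n F)) λ i → allL (allFin (n F)) λ j →
       ⌊ edge H (lookup φ i) (lookup φ j) Bool.≟ adj F i j ⌋)

isIsomorphism-true⁻ : ∀ F (H : SubData m) φ → isIsomorphism F H φ ≡ true → IsIsomorphism F H φ
isIsomorphism-true⁻ F H φ iso =
  let inj , rest₁ = ∧-true⁻ iso ; into , rest₂ = ∧-true⁻ rest₁ ; onto , edges = ∧-true⁻ rest₂ in
  record
  { injective = isInjective-true⁻ φ inj
  ; into      = all-Fin-true⁻ _ into
  ; onto      = λ u u∈H → inImage-true⁻ φ (⇒b-true⁻ (all-Fin-true⁻ _ onto u) u∈H)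
  ; edge-iff  = λ i j → ≟-true⁻ (all-Fin-true⁻ _ (all-Fin-true⁻ _ edges i) j)
  }

isIsomorphism-true⁺ : ∀ F (H : SubData m) φ → IsIsomorphism F H φ → isIsomorphism F H φ ≡ true
isIsomorphism-true⁺ F H φ iso =
  ∧-true⁺ (isInjective-true⁺ φ injective) (∧-true⁺ (all-Fin-true⁺ _ into) (∧-true⁺
    (all-Fin-true⁺ _ λ u → ⇒b-true⁺ λ u∈H → let i , φi≡u = onto u u∈H in
      subst (λ w → inImage φ w ≡ true) φi≡u (inImage-lookup φ i))
    (all-Fin-true⁺ _ λ i → all-Fin-true⁺ _ λ j → ≟-true⁺ (edge-iff i j))))
  where open IsIsomorphism iso

wholeSubData : (F : Graph) → SubData (n F)
wholeSubData F = replicate (n F) true , tabulate λ i → tabulate λ j → adj F i j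

edge-wholeSubData : ∀ F u w → edge (wholeSubData F) u w ≡ adj F u w
edge-wholeSubData F u w = trans (cong (λ row → lookup row w) (Vecₚ.lookup∘tabulate _ u)) (Vecₚ.lookup∘tabulate _ w)

IsAutomorphism : (F : Graph) → Vec (Fin (n F)) (n F) → Set
IsAutomorphism F = IsIsomorphism F (wholeSubData F)

isAutomorphism : (F : Graph) → Vec (Fin (n F)) (n F) → Bool
isAutomorphism F = isIsomorphism F (wholeSubData F)

#automorphisms : Graph → ℕ
#automorphisms F = countL (vectors (n F) (n F)) (isAutomorphism F)

automorphism-surjective : ∀ {F σ} → IsAutomorphism F σ → ∀ u → Σ (Fin (n F)) λ i → lookup σ i ≡ u
automorphism-surjective {F} aut u = IsIsomorphism.onto aut u (Vecₚ.lookup-replicate u true)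

automorphism-adj : ∀ {F σ} → IsAutomorphism F σ → ∀ i j → adj F (lookup σ i) (lookup σ j) ≡ adj F i j
automorphism-adj {F} {σ} aut i j = trans (sym (edge-wholeSubData F _ _)) (IsIsomorphism.edge-iff aut i j)

mkAutomorphism : ∀ {F σ} → (∀ i j → lookup σ i ≡ lookup σ j → i ≡ j) →
  (∀ u → Σ (Fin (n F)) λ i → lookup σ i ≡ u) →
  (∀ i j → adj F (lookup σ i) (lookup σ j) ≡ adj F i j) → IsAutomorphism F σ
mkAutomorphism {F} {σ} inj surj adj≡ = record
  { injective = inj
  ; into      = λ i → Vecₚ.lookup-replicate (lookup σ i) true
  ; onto      = λ u _ → surj u
  ; edge-iff  = λ i j → trans (edge-wholeSubData F _ _) (adj≡ i j)
  }

1≤#automorphisms : ∀ F → 1 ≤ #automorphisms F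
1≤#automorphisms F = countL-positive (isAutomorphism F) (∈-vectors (Vec.allFin (n F)))
  (isIsomorphism-true⁺ F (wholeSubData F) (Vec.allFin (n F)) (mkAutomorphism
    (λ i j eq → trans (sym (Vecₚ.lookup-allFin i)) (trans eq (Vecₚ.lookup-allFin j)))
    (λ u → u , Vecₚ.lookup-allFin u)
    (λ i j → cong₂ (adj F) (Vecₚ.lookup-allFin i) (Vecₚ.lookup-allFin j))))

imageEdge : (F : Graph) → Vec (Fin m) (n F) → Fin m → Fin m → Bool
imageEdge F φ u w = anyL (allFin (n F)) λ i → anyL (allFin (n F)) λ j →
  (lookup φ i == u) ∧ (lookup φ j == w) ∧ adj F i j

imageSubgraph : (F : Graph) → Vec (Fin m) (n F) → SubData m
imageSubgraph F φ = tabulate (inImage φ) , tabulate λ u → tabulate λ w → imageEdge F φ u w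

vertices-imageSubgraph : ∀ F (φ : Vec (Fin m) (n F)) u → lookup (vertices (imageSubgraph F φ)) u ≡ inImage φ u
vertices-imageSubgraph F φ u = Vecₚ.lookup∘tabulate _ u

edge-imageSubgraph : ∀ F (φ : Vec (Fin m) (n F)) u w → edge (imageSubgraph F φ) u w ≡ imageEdge F φ u w
edge-imageSubgraph F φ u w = trans (cong (λ row → lookup row w) (Vecₚ.lookup∘tabulate _ u)) (Vecₚ.lookup∘tabulate _ w)

edge-imageSubgraph-true⁻ : ∀ F (φ : Vec (Fin m) (n F)) {u w} → edge (imageSubgraph F φ) u w ≡ true →
  Σ (Fin (n F)) λ i → Σ (Fin (n F)) λ j → lookup φ i ≡ u × lookup φ j ≡ w × adj F i j ≡ true
edge-imageSubgraph-true⁻ F φ {u} {w} uw =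
  let i , ∃j = any-Fin-true⁻ _ (trans (sym (edge-imageSubgraph F φ u w)) uw)
      j , ij = any-Fin-true⁻ _ ∃j
      φi≡u , rest = ∧-true⁻ ij
      φj≡w , Fij  = ∧-true⁻ rest
  in i , j , ==-true⁻ φi≡u , ==-true⁻ φj≡w , Fij

edge-imageSubgraph-true⁺ : ∀ F (φ : Vec (Fin m) (n F)) {i j} → adj F i j ≡ true →
  edge (imageSubgraph F φ) (lookup φ i) (lookup φ j) ≡ true
edge-imageSubgraph-true⁺ F φ {i} {j} ij = trans (edge-imageSubgraph F φ _ _)
  (any-Fin-true⁺ _ i (any-Fin-true⁺ _ j (∧-true⁺ (==-true⁺ {a = lookup φ i} refl) (∧-true⁺ (==-true⁺ {a = lookup φ j} refl) ij))))

imageSubgraph-isomorphism : ∀ F (φ : Vec (Fin m) (n F)) → (∀ i j → lookup φ i ≡ lookup φ j → i ≡ j) →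
  IsIsomorphism F (imageSubgraph F φ) φ
imageSubgraph-isomorphism F φ inj = record
  { injective = inj
  ; into      = λ i → trans (vertices-imageSubgraph F φ _) (inImage-lookup φ i)
  ; onto      = λ u u∈ → inImage-true⁻ φ (trans (sym (vertices-imageSubgraph F φ u)) u∈)
  ; edge-iff  = λ i j → Bool-ext
      (λ φiφj → let i′ , j′ , φi′≡φi , φj′≡φj , Fi′j′ = edge-imageSubgraph-true⁻ F φ φiφj in
        subst₂ (λ x y → adj F x y ≡ true) (inj _ _ φi′≡φi) (inj _ _ φj′≡φj) Fi′j′)
      (edge-imageSubgraph-true⁺ F φ)
  }

embedding-imageSubgraph : ∀ F X φ → IsEmbedding F X φ → IsSubgraph X (imageSubgraph F φ)
embedding-imageSubgraph F X φ emb = record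
  { edge-sym   = λ u w uw → let i , j , φi≡u , φj≡w , Fij = edge-imageSubgraph-true⁻ F φ uw in
      subst₂ (λ x y → edge (imageSubgraph F φ) x y ≡ true) φj≡w φi≡u
        (edge-imageSubgraph-true⁺ F φ (trans (Graph.sym F j i) Fij))
  ; edge-valid = λ u w uw → let i , j , φi≡u , φj≡w , Fij = edge-imageSubgraph-true⁻ F φ uw in
      subst (λ x → lookup (vertices (imageSubgraph F φ)) x ≡ true) φi≡u (into i) ,
      subst (λ x → lookup (vertices (imageSubgraph F φ)) x ≡ true) φj≡w (into j) ,
      subst₂ (λ x y → adj X x y ≡ true) φi≡u φj≡w (IsEmbedding.adj-preserving emb i j Fij)
  }
  where open IsIsomorphism (imageSubgraph-isomorphism F φ (IsEmbedding.injective emb))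

isomorphism-≡-imageSubgraph : ∀ {X} F (H : SubData (n X)) φ → IsSubgraph X H → IsIsomorphism F H φ →
  H ≡ imageSubgraph F φ
isomorphism-≡-imageSubgraph F H φ sub iso =
  cong₂ _,_ (lookup-ext sameVertex) (lookup-ext λ u → lookup-ext λ w → trans (sameEdge u w) (sym (edge-imageSubgraph F φ u w) ))
  where
  open IsIsomorphism iso
  open IsSubgraph sub
  sameVertex : ∀ u → lookup (vertices H) u ≡ lookup (vertices (imageSubgraph F φ)) u
  sameVertex u = trans (Bool-ext
    (λ u∈H → let i , φi≡u = onto u u∈H in subst (λ x → inImage φ x ≡ true) φi≡u (inImage-lookup φ i))
    (λ u∈φ → let i , φi≡u = inImage-true⁻ φ u∈φ in subst (λ x → lookup (vertices H) x ≡ true) φi≡u (into i)))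
    (sym (vertices-imageSubgraph F φ u))
  sameEdge : ∀ u w → edge H u w ≡ imageEdge F φ u w
  sameEdge u w = Bool-ext
    (λ uw → let u∈H , w∈H , _ = edge-valid u w uw ; i , φi≡u = onto u u∈H ; j , φj≡w = onto w w∈H in
      trans (sym (edge-imageSubgraph F φ u w))
        (subst₂ (λ x y → edge (imageSubgraph F φ) x y ≡ true) φi≡u φj≡w (edge-imageSubgraph-true⁺ F φ
          (trans (sym (edge-iff i j)) (subst₂ (λ x y → edge H x y ≡ true) (sym φi≡u) (sym φj≡w) uw)))))
    (λ uw → let i , j , φi≡u , φj≡w , Fij = edge-imageSubgraph-true⁻ F φ (trans (edge-imageSubgraph F φ u w) uw) in
      subst₂ (λ x y → edge H x y ≡ true) φi≡u φj≡w (trans (edge-iff i j) Fij))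

isomorphism-∘-automorphism : ∀ {F} {H : SubData m} {ψ σ} → IsIsomorphism F H ψ → IsAutomorphism F σ →
  IsIsomorphism F H (Vec.map (lookup ψ) σ)
isomorphism-∘-automorphism {F = F} {H} {ψ} {σ} iso aut = record
  { injective = λ i j eq → IsIsomorphism.injective aut i j
      (injective _ _ (trans (sym (Vecₚ.lookup-map i _ σ)) (trans eq (Vecₚ.lookup-map j _ σ))))
  ; into      = λ i → subst (λ x → lookup (vertices H) x ≡ true) (sym (Vecₚ.lookup-map i _ σ)) (into _)
  ; onto      = λ u u∈H → let j , ψj≡u = onto u u∈H ; i , σi≡j = automorphism-surjective aut j in
      i , trans (Vecₚ.lookup-map i _ σ) (trans (cong (lookup ψ) σi≡j) ψj≡u)
  ; edge-iff  = λ i j → trans (cong₂ (edge H) (Vecₚ.lookup-map i _ σ) (Vecₚ.lookup-map j _ σ))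
      (trans (edge-iff _ _) (automorphism-adj aut i j))
  }
  where open IsIsomorphism iso

_⁻¹∘_ : ∀ {k} → Vec (Fin m) k → Vec (Fin m) k → Vec (Fin k) k
_⁻¹∘_ {k = k} ψ φ = tabulate λ i → firstL (λ j → lookup ψ j == lookup φ i) i (allFin k)

lookup-⁻¹∘ : ∀ {k} (ψ φ : Vec (Fin m) k) → (∀ i → Σ (Fin k) λ j → lookup ψ j ≡ lookup φ i) →
  ∀ i → lookup ψ (lookup (ψ ⁻¹∘ φ) i) ≡ lookup φ i
lookup-⁻¹∘ {k = k} ψ φ hit i = ==-true⁻ (subst (λ j → (lookup ψ j == lookup φ i) ≡ true)
  (sym (Vecₚ.lookup∘tabulate _ i))
  (firstL-satisfies (λ j → lookup ψ j == lookup φ i) i (allFin k)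
    (let j , ψj≡φi = hit i in any-Fin-true⁺ (λ j → lookup ψ j == lookup φ i) j (==-true⁺ ψj≡φi))))

⁻¹∘-automorphism : ∀ {F} {H : SubData m} {ψ φ} → IsIsomorphism F H ψ → IsIsomorphism F H φ →
  IsAutomorphism F (ψ ⁻¹∘ φ)
⁻¹∘-automorphism {F = F} {H} {ψ} {φ} ψ-iso φ-iso = mkAutomorphism
  (λ i j eq → φ.injective i j (trans (sym (ψσ≡φ i)) (trans (cong (lookup ψ) eq) (ψσ≡φ j))))
  (λ u → let i , φi≡ψu = φ.onto (lookup ψ u) (ψ.into u) in
    i , ψ.injective _ _ (trans (ψσ≡φ i) φi≡ψu))
  (λ i j → begin
    adj F (lookup σ i) (lookup σ j)                     ≡⟨ ψ.edge-iff _ _ ⟨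
    edge H (lookup ψ (lookup σ i)) (lookup ψ (lookup σ j)) ≡⟨ cong₂ (edge H) (ψσ≡φ i) (ψσ≡φ j) ⟩
    edge H (lookup φ i) (lookup φ j)                    ≡⟨ φ.edge-iff i j ⟩
    adj F i j                                           ∎)
  where
  module ψ = IsIsomorphism ψ-iso
  module φ = IsIsomorphism φ-iso
  σ = ψ ⁻¹∘ φ
  ψσ≡φ : ∀ i → lookup ψ (lookup σ i) ≡ lookup φ i
  ψσ≡φ = lookup-⁻¹∘ ψ φ λ i → ψ.onto (lookup φ i) (φ.into i)
  open ≡-Reasoning

isomorphism-embedding : ∀ {F X} {H : SubData (n X)} {φ} → IsSubgraph X H → IsIsomorphism F H φ → IsEmbedding F X φ
isomorphism-embedding sub iso = record
  { injective      = IsIsomorphism.injective iso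
  ; adj-preserving = λ i j ij →
      proj₂ (proj₂ (IsSubgraph.edge-valid sub _ _ (trans (IsIsomorphism.edge-iff iso i j) ij)))
  }

module _ (F X : Graph) (u₀ : Fin (n X)) where

  -- u₀ only provides the default value of the search; for a copy H an isomorphism is always found.
  canonicalIsomorphism : SubData (n X) → Vec (Fin (n X)) (n F)
  canonicalIsomorphism H = firstL (isIsomorphism F H) (replicate (n F) u₀) (vectors (n X) (n F))

  canonicalIsomorphism-isomorphism : ∀ H → isIsoTo F H ≡ true → IsIsomorphism F H (canonicalIsomorphism H)
  canonicalIsomorphism-isomorphism H iso = isIsomorphism-true⁻ F H _
    (firstL-satisfies (isIsomorphism F H) (replicate (n F) u₀) (vectors (n X) (n F)) iso)

  copyPairs : List (SubData (n X) × Vec (Fin (n F)) (n F))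
  copyPairs = cartesianProduct (allSubData (n X)) (vectors (n F) (n F))

  isCopyPair : SubData (n X) × Vec (Fin (n F)) (n F) → Bool
  isCopyPair = isCopy F X ∧ᵈ λ _ → isAutomorphism F

  #copyPairs : countL copyPairs isCopyPair ≡ #automorphisms F * copies F X
  #copyPairs = ≤-antisym
    (countL-cartesianProduct-≤ (allSubData (n X)) _ (isCopy F X) _ (#automorphisms F) λ _ _ → ≤-refl)
    (countL-cartesianProduct-≥ (allSubData (n X)) _ (isCopy F X) _ (#automorphisms F) λ _ _ → ≤-refl)

  private
    ψ : SubData (n X) → Vec (Fin (n X)) (n F)
    ψ = canonicalIsomorphism

  copyPair : Vec (Fin (n X)) (n F) → SubData (n X) × Vec (Fin (n F)) (n F)
  copyPair φ = imageSubgraph F φ , ψ (imageSubgraph F φ) ⁻¹∘ φ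

  embeddingOf : SubData (n X) × Vec (Fin (n F)) (n F) → Vec (Fin (n X)) (n F)
  embeddingOf (H , σ) = Vec.map (lookup (ψ H)) σ

  module _ (φ : Vec (Fin (n X)) (n F)) (emb : IsEmbedding F X φ) where
    private
      H = imageSubgraph F φ
      φ-iso = imageSubgraph-isomorphism F φ (IsEmbedding.injective emb)

    isCopy-imageSubgraph : isCopy F X H ≡ true
    isCopy-imageSubgraph = ∧-true⁺ (isSubgraph-true⁺ X H (embedding-imageSubgraph F X φ emb))
      (anyL-true⁺ (vectors (n X) (n F)) (isIsomorphism F H) (∈-vectors φ) (isIsomorphism-true⁺ F H φ φ-iso))

    canonicalIsomorphism-imageSubgraph : IsIsomorphism F H (ψ H)
    canonicalIsomorphism-imageSubgraph = canonicalIsomorphism-isomorphism H (proj₂ (∧-true⁻ isCopy-imageSubgraph))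

    copyPair-isCopyPair : isCopyPair (copyPair φ) ≡ true
    copyPair-isCopyPair = ∧-true⁺ isCopy-imageSubgraph
      (isIsomorphism-true⁺ F (wholeSubData F) _ (⁻¹∘-automorphism canonicalIsomorphism-imageSubgraph φ-iso))

    lookup-copyPair : ∀ i → lookup (ψ H) (lookup (proj₂ (copyPair φ)) i) ≡ lookup φ i
    lookup-copyPair = lookup-⁻¹∘ (ψ H) φ λ i →
      IsIsomorphism.onto canonicalIsomorphism-imageSubgraph (lookup φ i) (IsIsomorphism.into φ-iso i)

  isCopyPair-true⁻ : ∀ H σ → isCopyPair (H , σ) ≡ true →
    IsSubgraph X H × isIsoTo F H ≡ true × IsAutomorphism F σ
  isCopyPair-true⁻ H σ pair =
    let copy , aut = ∧-true⁻ {isCopy F X H} pair ; sub , iso = ∧-true⁻ {isSubgraph X H} copy in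
    isSubgraph-true⁻ X H sub , iso , isIsomorphism-true⁻ F (wholeSubData F) σ aut

  module _ (H : SubData (n X)) (σ : Vec (Fin (n F)) (n F)) (pair : isCopyPair (H , σ) ≡ true) where
    private
      H-sub = proj₁ (isCopyPair-true⁻ H σ pair)
      iso   = proj₁ (proj₂ (isCopyPair-true⁻ H σ pair))
      aut   = proj₂ (proj₂ (isCopyPair-true⁻ H σ pair))

    embeddingOf-isomorphism : IsIsomorphism F H (embeddingOf (H , σ))
    embeddingOf-isomorphism = isomorphism-∘-automorphism (canonicalIsomorphism-isomorphism H iso) aut

    embeddingOf-embedding : IsEmbedding F X (embeddingOf (H , σ))
    embeddingOf-embedding = isomorphism-embedding H-sub embeddingOf-isomorphism

    ≡-imageSubgraph-embeddingOf : H ≡ imageSubgraph F (embeddingOf (H , σ))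
    ≡-imageSubgraph-embeddingOf = isomorphism-≡-imageSubgraph F H (embeddingOf (H , σ)) H-sub embeddingOf-isomorphism

    canonicalIsomorphism-injective : ∀ i j → lookup (ψ H) i ≡ lookup (ψ H) j → i ≡ j
    canonicalIsomorphism-injective = IsIsomorphism.injective (canonicalIsomorphism-isomorphism H iso)

  embeddingOf-injective : ∀ {H₁ σ₁ H₂ σ₂} → isCopyPair (H₁ , σ₁) ≡ true → isCopyPair (H₂ , σ₂) ≡ true →
    embeddingOf (H₁ , σ₁) ≡ embeddingOf (H₂ , σ₂) → (H₁ , σ₁) ≡ (H₂ , σ₂)
  embeddingOf-injective {H₁} {σ₁} {H₂} {σ₂} pair₁ pair₂ eq = cong₂ _,_ H₁≡H₂
    (lookup-ext λ i → canonicalIsomorphism-injective H₂ σ₂ pair₂ _ _ (begin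
      lookup (ψ H₂) (lookup σ₁ i)      ≡⟨ cong (λ H → lookup (ψ H) (lookup σ₁ i)) H₁≡H₂ ⟨
      lookup (ψ H₁) (lookup σ₁ i)      ≡⟨ Vecₚ.lookup-map i (lookup (ψ H₁)) σ₁ ⟨
      lookup (embeddingOf (H₁ , σ₁)) i ≡⟨ cong (λ φ → lookup φ i) eq ⟩
      lookup (embeddingOf (H₂ , σ₂)) i ≡⟨ Vecₚ.lookup-map i (lookup (ψ H₂)) σ₂ ⟩
      lookup (ψ H₂) (lookup σ₂ i)      ∎))
    where
    open ≡-Reasoning
    H₁≡H₂ : H₁ ≡ H₂
    H₁≡H₂ = trans (≡-imageSubgraph-embeddingOf H₁ σ₁ pair₁)
      (trans (cong (imageSubgraph F) eq) (sym (≡-imageSubgraph-embeddingOf H₂ σ₂ pair₂)))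

  copyPair-injective : ∀ {φ₁ φ₂} → IsEmbedding F X φ₁ → IsEmbedding F X φ₂ → copyPair φ₁ ≡ copyPair φ₂ → φ₁ ≡ φ₂
  copyPair-injective {φ₁} {φ₂} emb₁ emb₂ eq = lookup-ext λ i → begin
    lookup φ₁ i                                                        ≡⟨ lookup-copyPair φ₁ emb₁ i ⟨
    lookup (ψ (proj₁ (copyPair φ₁))) (lookup (proj₂ (copyPair φ₁)) i) ≡⟨ cong (λ (H , σ) → lookup (ψ H) (lookup σ i)) eq ⟩
    lookup (ψ (proj₁ (copyPair φ₂))) (lookup (proj₂ (copyPair φ₂)) i) ≡⟨ lookup-copyPair φ₂ emb₂ i ⟩
    lookup φ₂ i                                                        ∎
    where open ≡-Reasoning

  #embeddings≡#automorphisms*copies : #embeddings F X ≡ #automorphisms F * copies F X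
  #embeddings≡#automorphisms*copies = trans (≤-antisym #embeddings≤#copyPairs #copyPairs≤#embeddings) #copyPairs
    where
    #embeddings≤#copyPairs : #embeddings F X ≤ countL copyPairs isCopyPair
    #embeddings≤#copyPairs = countL-≤-injection copyPair (vectors-unique (n X) (n F))
      (λ {φ} _ emb → ∈-cartesianProduct⁺ (∈-allSubData _) (∈-vectors _) ,
                     copyPair-isCopyPair φ (isEmbedding-true⁻ F X φ emb))
      (λ {φ₁} {φ₂} _ _ emb₁ emb₂ → copyPair-injective (isEmbedding-true⁻ F X φ₁ emb₁) (isEmbedding-true⁻ F X φ₂ emb₂))
    #copyPairs≤#embeddings : countL copyPairs isCopyPair ≤ #embeddings F X
    #copyPairs≤#embeddings = countL-≤-injection embeddingOf
      (Uniqueₚ.cartesianProduct⁺ (allSubData-unique (n X)) (vectors-unique (n F) (n F)))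
      (λ {(H , σ)} _ pair → ∈-vectors _ , isEmbedding-true⁺ F X _ (embeddingOf-embedding H σ pair))
      (λ {(H₁ , σ₁)} {(H₂ , σ₂)} _ _ → embeddingOf-injective)

degree<n : ∀ G v → degree G v < n G
degree<n G v = subst (suc (degree G v) ≤_) (length-allFin (n G)) (countL<length (adj G v) (∈-allFin v) (irrefl G v))

lemma6p4 : (F : Graph) → IsForest F → (d : ℕ) → (G : Graph) → 1 ≤ n G
         → MinDegreeAtLeast G d → copies F (K (suc d)) ≤ copies F G
lemma6p4 F forest d G 1≤n δ = *-cancelˡ-≤ (#automorphisms F) ⦃ >-nonZero (1≤#automorphisms F) ⦄ (begin
  #automorphisms F * copies F (K (suc d)) ≡⟨ #embeddings≡#automorphisms*copies F (K (suc d)) zero ⟨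
  #embeddings F (K (suc d))               ≤⟨ #embeddings-K-≤ d F ⟩
  suc d P′ n F                            ≤⟨ #embeddings-forest-≥ G δ (≤-trans (s≤s (δ u₀)) (degree<n G u₀)) F forest ⟩
  #embeddings F G                         ≡⟨ #embeddings≡#automorphisms*copies F G u₀ ⟩
  #automorphisms F * copies F G           ∎)
  where
  open ≤-Reasoning
  u₀ : Fin (n G)
  u₀ = fromℕ< 1≤n
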